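{- Let $G$ be a connected graph, $S\subseteq V(G)$, and $k\ge 2$ an integer. If $V(G)$ has a partition into nonempty sets $T_1,\dots,T_m$ such that each induced subgraph $G[T_i]$ is connected, $|T_i|=k$ for all $i\le m-1$, and $|T_m|\le k$, then \[|S|+\frac{|V(G)|_k}{k-1}\geq w_k(G,S).\]
   Context: For a finite set $X$ and integer $k\ge2$, $|X|_k$ denotes the unique $j\in\{0,1,\dots,k-1\}$ with $|X|\equiv j \pmod k$. For a graph $G$ and $S\subseteq V(G)$, $w_k(G,S)=\frac{1}{k-1}\sum\{|V(C)|_k : C \text{ a connected component of } G-S\}$. -}

module Defs where

open import Data.Bool using (Bool; true; false)
open import Data.Nat using (ℕ; zero; suc; _+_; _%_)
open import Data.Fin using (Fin; zero; suc)
open import Data.Fin.Subset using (Subset; _∈_; _∉_; ⊤; Nonempty)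
open import Data.Product using (∃; _×_)
open import Relation.Binary.PropositionalEquality using (_≡_)
open import Relation.Nullary using (¬_)

record Graph : Set where
  field
    n     : ℕ
    adj   : Fin n → Fin n → Bool
    sym   : ∀ u v → adj u v ≡ adj v u
    irrfl : ∀ v → adj v v ≡ false
open Graph public

data WalkIn (G : Graph) (T : Subset (n G)) : Fin (n G) → Fin (n G) → Set where
  here : ∀ {u} → u ∈ T → WalkIn G T u u
  step : ∀ {u w v} → u ∈ T → adj G u w ≡ true → WalkIn G T w v → WalkIn G T u v

InducedConnected : (G : Graph) → Subset (n G) → Set
InducedConnected G T = Nonempty T × (∀ u v → u ∈ T → v ∈ T → WalkIn G T u v)

Connected : Graph → Set
Connected G = InducedConnected G ⊤

Disjoint : ∀ {m} → Subset m → Subset m → Set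
Disjoint A B = ∀ x → x ∈ A → x ∉ B

-- C is (the vertex set of) a connected component of G - S:
-- C avoids S, G[C] is connected (and nonempty), and C is closed under
-- adjacency within V(G) ∖ S (maximality).
IsComponent : (G : Graph) → Subset (n G) → Subset (n G) → Set
IsComponent G S C =
  (∀ v → v ∈ C → v ∉ S) ×
  InducedConnected G C ×
  (∀ u v → u ∈ C → v ∉ S → adj G u v ≡ true → v ∈ C)

IsComponentList : (G : Graph) (S : Subset (n G)) {r : ℕ} → (Fin r → Subset (n G)) → Set
IsComponentList G S {r} C =
  (∀ i → IsComponent G S (C i)) ×
  (∀ i j → ¬ (i ≡ j) → Disjoint (C i) (C j)) ×
  (∀ v → v ∉ S → ∃ λ i → v ∈ C i)

-- |x|_k : residue of x modulo k (only used for k ≥ 2).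
modk : ℕ → ℕ → ℕ
modk x zero = x
modk x (suc j) = x % suc j

sumFin : ∀ {r} → (Fin r → ℕ) → ℕ
sumFin {zero} f = 0
sumFin {suc r} f = f zero + sumFin (λ i → f (suc i))

{-# OPTIONS --safe #-}
-- Cut V(G) into the parts T_i. A component C of G - S satisfies
-- |C|_k ≤ Σ_i |C ∩ T_i|_k, so it suffices to bound, part by part, the sum over
-- components of |C ∩ T_i|_k. If T_i contains s ≥ 1 vertices of S, the
-- components cover at most k - s ≤ (k - 1) s of its vertices. If T_i avoids S,
-- it is connected in G - S and hence lies inside a single component: a full
-- part then contributes k ≡ 0, and only the last part can contribute, namely at
-- most |T_m| = |V(G)|_k.
module Submission where

open import Defs hiding (sym)
open import Data.Bool using (true; false; _∧_; if_then_else_)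
open import Data.Fin using (Fin; zero; suc; fromℕ; punchIn)
open import Data.Fin.Properties using (any?; punchInᵢ≢i)
open import Data.Fin.Subset using (Subset; ∣_∣; _∈_; _∉_; _⊆_; _∩_; ⊤; _-_)
open import Data.Fin.Subset.Properties
  using (_∈?_; ∣⊤∣≡n; ∣⊥∣≡0; ∩-comm; ∩-identityˡ; x∈p∩q⁺; x∈p∩q⁻;
         ∣p∩q∣≤∣q∣; p⊆q⇒∣p∣≤∣q∣; Empty-unique; x∈p⇒∣p-x∣<∣p∣)
open import Data.Nat using (ℕ; zero; suc; _≤_; _≥_; _<_; _+_; _*_; _∸_; _%_; z≤n; NonZero; ≢-nonZero)
open import Data.Nat.DivMod using (%-distribˡ-+; m%n%n≡m%n; m%n≤m; n%n≡0; m*n%n≡0; m<n⇒m%n≡m)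
open import Data.Nat.Properties
open import Data.Product using (∃; _,_; proj₁; proj₂)
open import Data.Sum using (_⊎_; inj₁; inj₂)
open import Data.Vec using ([]; _∷_; lookup)
open import Data.Vec.Properties using ([]=⇒lookup; lookup⇒[]=; lookup-zipWith)
open import Function using (_∘_)
open import Relation.Binary.PropositionalEquality
open import Relation.Nullary using (¬_; yes; no; contradiction)
open import Algebra.Properties.Semiring.Sum +-*-semiring
  using (sum; sum-syntax; sum-cong-≗; sum-remove; sum-replicate-zero; ∑-comm; ∑-distrib-+; *-distribˡ-sum)

private
  variable
    N r : ℕ

sumFin≡sum : (f : Fin r → ℕ) → sumFin f ≡ sum f
sumFin≡sum {zero}  f = refl
sumFin≡sum {suc r} f = cong (f zero +_) (sumFin≡sum (f ∘ suc))

sum-mono-≤ : {f g : Fin r → ℕ} → (∀ i → f i ≤ g i) → sum f ≤ sum g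
sum-mono-≤ {zero}  f≤g = z≤n
sum-mono-≤ {suc r} f≤g = +-mono-≤ (f≤g zero) (sum-mono-≤ (f≤g ∘ suc))

term≤sum : (f : Fin r → ℕ) (i : Fin r) → f i ≤ sum f
term≤sum f zero    = m≤m+n (f zero) _
term≤sum f (suc i) = ≤-trans (term≤sum (f ∘ suc) i) (m≤n+m _ (f zero))

sum-single : (f : Fin r → ℕ) (j : Fin r) → (∀ i → i ≢ j → f i ≡ 0) → sum f ≡ f j
sum-single {suc r} f j vanish = begin
  sum f                                   ≡⟨ sum-remove {i = j} f ⟩
  f j + sum (λ i → f (punchIn j i))       ≡⟨ cong (f j +_) (sum-cong-≗ (λ i → vanish _ (punchInᵢ≢i j i))) ⟩
  f j + sum {r} (λ _ → 0)                 ≡⟨ cong (f j +_) (sum-replicate-zero r) ⟩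
  f j + 0                                 ≡⟨ +-identityʳ (f j) ⟩
  f j                                     ∎
  where open ≡-Reasoning

[∑f]%d≡[∑[f%d]]%d : (f : Fin r → ℕ) (d : ℕ) .{{_ : NonZero d}} →
  sum f % d ≡ sum (λ i → f i % d) % d
[∑f]%d≡[∑[f%d]]%d {zero}  f d = refl
[∑f]%d≡[∑[f%d]]%d {suc r} f d = begin
  (f zero + sum (f ∘ suc)) % d                     ≡⟨ %-distribˡ-+ (f zero) _ d ⟩
  (f zero % d + sum (f ∘ suc) % d) % d             ≡⟨ cong (λ t → (f zero % d + t) % d) ([∑f]%d≡[∑[f%d]]%d (f ∘ suc) d) ⟩
  (f zero % d + ∑rest % d) % d                     ≡⟨ cong (λ t → (t + ∑rest % d) % d) (m%n%n≡m%n (f zero) d) ⟨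
  (f zero % d % d + ∑rest % d) % d                 ≡⟨ %-distribˡ-+ (f zero % d) ∑rest d ⟨
  (f zero % d + ∑rest) % d                         ∎
  where
  open ≡-Reasoning
  ∑rest = sum (λ i → f (suc i) % d)

[∑f]%d≤∑[f%d] : (f : Fin r → ℕ) (d : ℕ) .{{_ : NonZero d}} → sum f % d ≤ sum (λ i → f i % d)
[∑f]%d≤∑[f%d] f d = ≤-trans (≤-reflexive ([∑f]%d≡[∑[f%d]]%d f d)) (m%n≤m _ d)

χ : Subset N → Fin N → ℕ
χ p x = if lookup p x then 1 else 0

χ-∈ : {p : Subset N} {x : Fin N} → x ∈ p → χ p x ≡ 1
χ-∈ x∈p rewrite []=⇒lookup x∈p = refl

χ-∉ : {p : Subset N} {x : Fin N} → x ∉ p → χ p x ≡ 0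
χ-∉ {p = p} {x} x∉p with lookup p x in eq
... | true  = contradiction (lookup⇒[]= x p eq) x∉p
... | false = refl

χ-∩ : (p q : Subset N) (x : Fin N) → χ (p ∩ q) x ≡ χ p x * χ q x
χ-∩ p q x rewrite lookup-zipWith _∧_ x p q with lookup p x
... | true  = sym (+-identityʳ (χ q x))
... | false = refl

∣p∣≡∑χ : (p : Subset N) → ∣ p ∣ ≡ ∑[ x < N ] χ p x
∣p∣≡∑χ []          = refl
∣p∣≡∑χ (true ∷ p)  = cong suc (∣p∣≡∑χ p)
∣p∣≡∑χ (false ∷ p) = ∣p∣≡∑χ p

∣p∩q∣≡∑χp*χq : (p q : Subset N) → ∣ p ∩ q ∣ ≡ ∑[ x < N ] (χ p x * χ q x)
∣p∩q∣≡∑χp*χq p q = trans (∣p∣≡∑χ (p ∩ q)) (sum-cong-≗ (χ-∩ p q))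

∣p∣≡0⇒∉ : {p : Subset N} {x : Fin N} → ∣ p ∣ ≡ 0 → x ∉ p
∣p∣≡0⇒∉ {p = p} {x} ∣p∣≡0 x∈p = n≮0 (subst (∣ p - x ∣ <_) ∣p∣≡0 (x∈p⇒∣p-x∣<∣p∣ x∈p))

⊆⇒∣q∩p∣≡∣p∣ : {p q : Subset N} → p ⊆ q → ∣ q ∩ p ∣ ≡ ∣ p ∣
⊆⇒∣q∩p∣≡∣p∣ {p = p} {q} p⊆q =
  ≤-antisym (∣p∩q∣≤∣q∣ q p) (p⊆q⇒∣p∣≤∣q∣ (λ x∈p → x∈p∩q⁺ (p⊆q x∈p , x∈p)))

Disjoint⇒∣q∩p∣≡0 : {p q : Subset N} → Disjoint p q → ∣ q ∩ p ∣ ≡ 0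
Disjoint⇒∣q∩p∣≡0 {N} {p} {q} p#q = trans (cong ∣_∣ (Empty-unique empty)) (∣⊥∣≡0 N)
  where
  empty : ¬ ∃ λ x → x ∈ q ∩ p
  empty (x , x∈q∩p) = let (x∈q , x∈p) = x∈p∩q⁻ q p x∈q∩p in p#q x x∈p x∈q

PairwiseDisjoint : (Fin r → Subset N) → Set
PairwiseDisjoint F = ∀ i j → i ≢ j → Disjoint (F i) (F j)

Covers : (Fin r → Subset N) → Set
Covers F = ∀ x → ∃ λ i → x ∈ F i

∑χ≤1 : {F : Fin r → Subset N} → PairwiseDisjoint F → ∀ x → ∑[ i < r ] χ (F i) x ≤ 1
∑χ≤1 {r} {F = F} disjoint x with any? (λ i → x ∈? F i)
... | yes (j , x∈Fⱼ) = ≤-reflexive (trans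
        (sum-single _ j (λ i i≢j → χ-∉ (disjoint j i (i≢j ∘ sym) x x∈Fⱼ)))
        (χ-∈ x∈Fⱼ))
... | no  x∉⋃F = subst (_≤ 1) (sym (trans
        (sum-cong-≗ (λ i → χ-∉ (λ x∈Fᵢ → x∉⋃F (i , x∈Fᵢ))))
        (sum-replicate-zero r))) z≤n

∑χ≡1 : {F : Fin r → Subset N} → PairwiseDisjoint F → Covers F → ∀ x → ∑[ i < r ] χ (F i) x ≡ 1
∑χ≡1 {F = F} disjoint covers x with covers x
... | i , x∈Fᵢ = ≤-antisym (∑χ≤1 disjoint x)
                           (subst (_≤ _) (χ-∈ x∈Fᵢ) (term≤sum (λ j → χ (F j) x) i))

∑∣p∩Fᵢ∣≡∑χp*∑χF : (p : Subset N) (F : Fin r → Subset N) →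
  ∑[ i < r ] ∣ p ∩ F i ∣ ≡ ∑[ x < N ] (χ p x * ∑[ i < r ] χ (F i) x)
∑∣p∩Fᵢ∣≡∑χp*∑χF {N} {r} p F = begin
  ∑[ i < r ] ∣ p ∩ F i ∣                        ≡⟨ sum-cong-≗ (λ i → ∣p∩q∣≡∑χp*χq p (F i)) ⟩
  ∑[ i < r ] ∑[ x < N ] (χ p x * χ (F i) x)     ≡⟨ ∑-comm (λ i x → χ p x * χ (F i) x) ⟩
  ∑[ x < N ] ∑[ i < r ] (χ p x * χ (F i) x)     ≡⟨ sum-cong-≗ (λ x → *-distribˡ-sum (χ p x) (λ i → χ (F i) x)) ⟨
  ∑[ x < N ] (χ p x * ∑[ i < r ] χ (F i) x)     ∎
  where open ≡-Reasoning

∑∣p∩Fᵢ∣≤∣p∣ : (p : Subset N) {F : Fin r → Subset N} → PairwiseDisjoint F →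
  ∑[ i < r ] ∣ p ∩ F i ∣ ≤ ∣ p ∣
∑∣p∩Fᵢ∣≤∣p∣ {N} {r} p {F} disjoint = begin
  ∑[ i < r ] ∣ p ∩ F i ∣                     ≡⟨ ∑∣p∩Fᵢ∣≡∑χp*∑χF p F ⟩
  ∑[ x < N ] (χ p x * ∑[ i < r ] χ (F i) x)  ≤⟨ sum-mono-≤ (λ x → *-monoʳ-≤ (χ p x) (∑χ≤1 disjoint x)) ⟩
  ∑[ x < N ] (χ p x * 1)                     ≡⟨ sum-cong-≗ (λ x → *-identityʳ (χ p x)) ⟩
  ∑[ x < N ] χ p x                           ≡⟨ ∣p∣≡∑χ p ⟨
  ∣ p ∣                                      ∎
  where open ≤-Reasoning

∑∣p∩Fᵢ∣≡∣p∣ : (p : Subset N) {F : Fin r → Subset N} → PairwiseDisjoint F → Covers F →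
  ∑[ i < r ] ∣ p ∩ F i ∣ ≡ ∣ p ∣
∑∣p∩Fᵢ∣≡∣p∣ {N} {r} p {F} disjoint covers = begin
  ∑[ i < r ] ∣ p ∩ F i ∣                     ≡⟨ ∑∣p∩Fᵢ∣≡∑χp*∑χF p F ⟩
  ∑[ x < N ] (χ p x * ∑[ i < r ] χ (F i) x)  ≡⟨ sum-cong-≗ (λ x → cong (χ p x *_) (∑χ≡1 disjoint covers x)) ⟩
  ∑[ x < N ] (χ p x * 1)                     ≡⟨ sum-cong-≗ (λ x → *-identityʳ (χ p x)) ⟩
  ∑[ x < N ] χ p x                           ≡⟨ ∣p∣≡∑χ p ⟨
  ∣ p ∣                                      ∎
  where open ≡-Reasoning

∑∣Fᵢ∣≡N : {F : Fin r → Subset N} → PairwiseDisjoint F → Covers F → ∑[ i < r ] ∣ F i ∣ ≡ N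
∑∣Fᵢ∣≡N {r} {N} {F} disjoint covers = begin
  ∑[ i < r ] ∣ F i ∣       ≡⟨ sum-cong-≗ (λ i → cong ∣_∣ (∩-identityˡ (F i))) ⟨
  ∑[ i < r ] ∣ ⊤ ∩ F i ∣   ≡⟨ ∑∣p∩Fᵢ∣≡∣p∣ ⊤ disjoint covers ⟩
  ∣ ⊤ {N} ∣               ≡⟨ ∣⊤∣≡n N ⟩
  N                       ∎
  where open ≡-Reasoning

∑∣Tᵢ∣%k≡N%k : (k : ℕ) .{{_ : NonZero k}} {m : ℕ} {T : Fin (suc m) → Subset N} →
  PairwiseDisjoint T → Covers T → (∀ i → i ≢ fromℕ m → ∣ T i ∣ ≡ k) →
  ∑[ i < suc m ] (∣ T i ∣ % k) ≡ N % k
∑∣Tᵢ∣%k≡N%k {N} k {m} {T} disjoint covers full = begin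
  ∑[ i < suc m ] (∣ T i ∣ % k)          ≡⟨ only-last ⟩
  ∣ T (fromℕ m) ∣ % k                   ≡⟨ m%n%n≡m%n _ k ⟨
  ∣ T (fromℕ m) ∣ % k % k               ≡⟨ cong (_% k) only-last ⟨
  ∑[ i < suc m ] (∣ T i ∣ % k) % k      ≡⟨ [∑f]%d≡[∑[f%d]]%d (λ i → ∣ T i ∣) k ⟨
  ∑[ i < suc m ] ∣ T i ∣ % k            ≡⟨ cong (_% k) (∑∣Fᵢ∣≡N disjoint covers) ⟩
  N % k                                 ∎
  where
  open ≡-Reasoning
  only-last : ∑[ i < suc m ] (∣ T i ∣ % k) ≡ ∣ T (fromℕ m) ∣ % k
  only-last = sum-single _ (fromℕ m) (λ i i≢m → trans (cong (_% k) (full i i≢m)) (n%n≡0 k))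

walk-head : {G : Graph} {T : Subset (n G)} {u v : Fin (n G)} → WalkIn G T u v → u ∈ T
walk-head (here u∈T)     = u∈T
walk-head (step u∈T _ _) = u∈T

module _ {G : Graph} {S C : Subset (n G)} (component : IsComponent G S C) where

  walk-stays-in-component : {T : Subset (n G)} {u v : Fin (n G)} →
    Disjoint T S → WalkIn G T u v → u ∈ C → v ∈ C
  walk-stays-in-component T#S (here _)          u∈C = u∈C
  walk-stays-in-component T#S (step _ u~w w⇝v) u∈C =
    walk-stays-in-component T#S w⇝v (proj₂ (proj₂ component) _ _ u∈C (T#S _ (walk-head w⇝v)) u~w)

  connected-⊆-or-disjoint : {T : Subset (n G)} → InducedConnected G T → Disjoint T S →
    T ⊆ C ⊎ Disjoint T C
  connected-⊆-or-disjoint ((u , u∈T) , walk) T#S with u ∈? C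
  ... | yes u∈C = inj₁ (λ {v} v∈T → walk-stays-in-component T#S (walk u v u∈T v∈T) u∈C)
  ... | no  u∉C = inj₂ (λ v v∈T v∈C → u∉C (walk-stays-in-component T#S (walk v u v∈T u∈T) v∈C))

module _ {G : Graph} {S : Subset (n G)} {r : ℕ} {C : Fin r → Subset (n G)}
         (components : ∀ c → IsComponent G S (C c)) (disjoint : PairwiseDisjoint C)
         (k : ℕ) .{{_ : NonZero k}} where

  ∑∣Cc∩T∣+∣S∩T∣≤∣T∣ : (T : Subset (n G)) → ∑[ c < r ] ∣ C c ∩ T ∣ + ∣ S ∩ T ∣ ≤ ∣ T ∣
  ∑∣Cc∩T∣+∣S∩T∣≤∣T∣ T = begin
    ∑[ c < r ] ∣ C c ∩ T ∣ + ∣ S ∩ T ∣   ≡⟨ +-comm _ ∣ S ∩ T ∣ ⟩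
    ∑[ i < suc r ] ∣ S∷C i ∩ T ∣         ≡⟨ sum-cong-≗ (λ i → cong ∣_∣ (∩-comm (S∷C i) T)) ⟩
    ∑[ i < suc r ] ∣ T ∩ S∷C i ∣         ≤⟨ ∑∣p∩Fᵢ∣≤∣p∣ T S∷C-disjoint ⟩
    ∣ T ∣                                ∎
    where
    open ≤-Reasoning
    S∷C : Fin (suc r) → Subset (n G)
    S∷C zero    = S
    S∷C (suc c) = C c
    S∷C-disjoint : PairwiseDisjoint S∷C
    S∷C-disjoint zero    zero    0≢0 = contradiction refl 0≢0
    S∷C-disjoint zero    (suc c) _   x x∈S x∈C = proj₁ (components c) x x∈C x∈S
    S∷C-disjoint (suc c) zero    _   x x∈C     = proj₁ (components c) x x∈C
    S∷C-disjoint (suc c) (suc d) c≢d = disjoint c d (c≢d ∘ cong suc)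

  residues-in-part-meeting-S : (T : Subset (n G)) → ∣ T ∣ ≤ k → ∣ S ∩ T ∣ ≢ 0 →
    ∑[ c < r ] (∣ C c ∩ T ∣ % k) ≤ (k ∸ 1) * ∣ S ∩ T ∣
  residues-in-part-meeting-S T ∣T∣≤k s≢0 = begin
    ∑[ c < r ] (∣ C c ∩ T ∣ % k)   ≤⟨ sum-mono-≤ (λ c → m%n≤m ∣ C c ∩ T ∣ k) ⟩
    ∑[ c < r ] ∣ C c ∩ T ∣         ≤⟨ m+n≤o⇒m≤o∸n _ (begin
       ∑[ c < r ] ∣ C c ∩ T ∣ + 1              ≤⟨ +-monoʳ-≤ _ (n≢0⇒n>0 s≢0) ⟩
       ∑[ c < r ] ∣ C c ∩ T ∣ + ∣ S ∩ T ∣      ≤⟨ ∑∣Cc∩T∣+∣S∩T∣≤∣T∣ T ⟩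
       ∣ T ∣                                  ≤⟨ ∣T∣≤k ⟩
       k                                      ∎) ⟩
    k ∸ 1                          ≤⟨ m≤m*n (k ∸ 1) _ {{≢-nonZero s≢0}} ⟩
    (k ∸ 1) * ∣ S ∩ T ∣            ∎
    where open ≤-Reasoning

  residues-in-part-avoiding-S : {T : Subset (n G)} → InducedConnected G T → ∣ T ∣ ≤ k →
    Disjoint T S → ∑[ c < r ] (∣ C c ∩ T ∣ % k) ≤ ∣ T ∣ % k
  residues-in-part-avoiding-S {T} T-connected ∣T∣≤k T#S with m≤n⇒m<n∨m≡n ∣T∣≤k
  ... | inj₁ ∣T∣<k = begin
    ∑[ c < r ] (∣ C c ∩ T ∣ % k)   ≡⟨ sum-cong-≗ (λ c → m<n⇒m%n≡m (≤-<-trans (∣p∩q∣≤∣q∣ (C c) T) ∣T∣<k)) ⟩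
    ∑[ c < r ] ∣ C c ∩ T ∣         ≤⟨ m≤m+n _ ∣ S ∩ T ∣ ⟩
    ∑[ c < r ] ∣ C c ∩ T ∣ + ∣ S ∩ T ∣ ≤⟨ ∑∣Cc∩T∣+∣S∩T∣≤∣T∣ T ⟩
    ∣ T ∣                          ≡⟨ m<n⇒m%n≡m ∣T∣<k ⟨
    ∣ T ∣ % k                      ∎
    where open ≤-Reasoning
  ... | inj₂ ∣T∣≡k =
    subst (_≤ ∣ T ∣ % k) (sym (trans (sum-cong-≗ residue≡0) (sum-replicate-zero r))) z≤n
    where
    residue≡0 : ∀ c → ∣ C c ∩ T ∣ % k ≡ 0
    residue≡0 c with connected-⊆-or-disjoint (components c) T-connected T#S
    ... | inj₁ T⊆C = trans (cong (_% k) (trans (⊆⇒∣q∩p∣≡∣p∣ T⊆C) ∣T∣≡k)) (n%n≡0 k)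
    ... | inj₂ T#C = trans (cong (_% k) (Disjoint⇒∣q∩p∣≡0 T#C)) (m*n%n≡0 0 k)

  residues-in-part : {T : Subset (n G)} → InducedConnected G T → ∣ T ∣ ≤ k →
    ∑[ c < r ] (∣ C c ∩ T ∣ % k) ≤ (k ∸ 1) * ∣ S ∩ T ∣ + ∣ T ∣ % k
  residues-in-part {T} T-connected ∣T∣≤k with ∣ S ∩ T ∣ ≟ 0
  ... | yes s≡0 = ≤-trans (residues-in-part-avoiding-S T-connected ∣T∣≤k T#S) (m≤n+m _ _)
    where
    T#S : Disjoint T S
    T#S x x∈T x∈S = ∣p∣≡0⇒∉ s≡0 (x∈p∩q⁺ (x∈S , x∈T))
  ... | no  s≢0 = ≤-trans (residues-in-part-meeting-S T ∣T∣≤k s≢0) (m≤m+n _ _)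

  ∑residues≤ : {m : ℕ} {T : Fin (suc m) → Subset (n G)} →
    (∀ i → InducedConnected G (T i)) → PairwiseDisjoint T → Covers T →
    (∀ i → i ≢ fromℕ m → ∣ T i ∣ ≡ k) → ∣ T (fromℕ m) ∣ ≤ k →
    ∑[ c < r ] (∣ C c ∣ % k) ≤ (k ∸ 1) * ∣ S ∣ + n G % k
  ∑residues≤ {m} {T} T-connected T-disjoint T-covers full last≤k = begin
    ∑[ c < r ] (∣ C c ∣ % k)                                  ≡⟨ sum-cong-≗ (λ c → cong (_% k) (∑∣p∩Fᵢ∣≡∣p∣ (C c) T-disjoint T-covers)) ⟨
    ∑[ c < r ] (∑[ i < suc m ] ∣ C c ∩ T i ∣ % k)             ≤⟨ sum-mono-≤ (λ c → [∑f]%d≤∑[f%d] (λ i → ∣ C c ∩ T i ∣) k) ⟩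
    ∑[ c < r ] ∑[ i < suc m ] (∣ C c ∩ T i ∣ % k)             ≡⟨ ∑-comm (λ c i → ∣ C c ∩ T i ∣ % k) ⟩
    ∑[ i < suc m ] ∑[ c < r ] (∣ C c ∩ T i ∣ % k)             ≤⟨ sum-mono-≤ (λ i → residues-in-part (T-connected i) (∣Tᵢ∣≤k i)) ⟩
    ∑[ i < suc m ] ((k ∸ 1) * ∣ S ∩ T i ∣ + ∣ T i ∣ % k)       ≡⟨ ∑-distrib-+ (λ i → (k ∸ 1) * ∣ S ∩ T i ∣) (λ i → ∣ T i ∣ % k) ⟩
    ∑[ i < suc m ] ((k ∸ 1) * ∣ S ∩ T i ∣) + ∑[ i < suc m ] (∣ T i ∣ % k)
      ≡⟨ cong₂ _+_ (sym (*-distribˡ-sum (k ∸ 1) (λ i → ∣ S ∩ T i ∣))) (∑∣Tᵢ∣%k≡N%k k T-disjoint T-covers full) ⟩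
    (k ∸ 1) * ∑[ i < suc m ] ∣ S ∩ T i ∣ + n G % k           ≡⟨ cong (λ s → (k ∸ 1) * s + n G % k) (∑∣p∩Fᵢ∣≡∣p∣ S T-disjoint T-covers) ⟩
    (k ∸ 1) * ∣ S ∣ + n G % k                                 ∎
    where
    open ≤-Reasoning
    ∣Tᵢ∣≤k : ∀ i → ∣ T i ∣ ≤ k
    ∣Tᵢ∣≤k i with i Data.Fin.≟ fromℕ m
    ... | yes refl = last≤k
    ... | no  i≢m  = ≤-reflexive (full i i≢m)

lemma29 : (G : Graph) → Connected G → (S : Subset (n G)) → (k : ℕ) → 2 ≤ k →
    (m : ℕ) (T : Fin (suc m) → Subset (n G)) →
    (∀ i → InducedConnected G (T i)) →
    (∀ i j → ¬ (i ≡ j) → Disjoint (T i) (T j)) →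
    (∀ v → ∃ λ i → v ∈ T i) →
    (∀ i → ¬ (i ≡ fromℕ m) → ∣ T i ∣ ≡ k) →
    ∣ T (fromℕ m) ∣ ≤ k →
    (r : ℕ) (C : Fin r → Subset (n G)) → IsComponentList G S C →
    (k ∸ 1) * ∣ S ∣ + modk (n G) k ≥ sumFin (λ i → modk ∣ C i ∣ k)
lemma29 G _ S zero ()
lemma29 G _ S (suc k) _ m T T-connected T-disjoint T-covers full last≤k r C (components , C-disjoint , _) =
  subst (_≤ k * ∣ S ∣ + n G % suc k) (sym (sumFin≡sum (λ c → ∣ C c ∣ % suc k)))
    (∑residues≤ components C-disjoint (suc k) T-connected T-disjoint T-covers full last≤k)
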